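{- Let $G$ be a balanced element-removal game with $w$ white elements and $b$ black elements. Then the value of $G$ equals the integer $w-b$, and the outcome of the game (who wins, given who moves first) does not depend on the strategies the players use.
   Context: An element-removal game is specified by a finite set $X$ whose elements are colored black or white, and a removability function $\rho\colon 2^X\to 2^X$ with $\rho(B)\cap A\subseteq\rho(A)\subseteq A$ for all $A\subseteq B\subseteq X$. From a position $A\subseteq X$ (initially $A=X$), the player to move (White or Black) removes an element of $\rho(A)$ of his own color; a player unable to move loses. Games are valued in Conway's sense with White as Left (positive) and Black as Right (negative). The options of a position are the positions reachable in one move (by either player); the elements of a position $A$ are the elements of $A$, and its removable elements are those of $\rho(A)$. A game (position) is balanced if (i) all its options are balanced, and (ii) whenever all its removable elements are of the same color, at least half of its elements have that color. -}

module Defs where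

open import Data.Nat using (ℕ; zero; suc; _*_; _≤_)
open import Data.Integer as ℤ using (ℤ; +_; -[1+_]; _-_)
open import Data.Fin using (Fin)
open import Data.Fin.Subset using (Subset; _∈_; _⊆_; _∩_; ∣_∣; ⊤; inside; outside)
  renaming (_-_ to _∖_)
open import Data.Vec using (tabulate)
open import Data.Product using (Σ; _×_; ∃)
open import Relation.Nullary using (¬_)
open import Relation.Binary.PropositionalEquality using (_≡_; _≢_)

-- Conway games (White = Left, Black = Right)

data Game : Set₁ where
  mkGame : (I : Set) → (I → Game) → (J : Set) → (J → Game) → Game

_≤G_ : Game → Game → Set
mkGame I L J R ≤G mkGame I' L' J' R' =
  ((i : I) → ¬ (mkGame I' L' J' R' ≤G L i)) ×
  ((j : J') → ¬ (R' j ≤G mkGame I L J R))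

_≈G_ : Game → Game → Set
G ≈G H = (G ≤G H) × (H ≤G G)

data Empty : Set where

natGame : ℕ → Game
natGame zero = mkGame Empty (λ ()) Empty (λ ())
natGame (suc k) = mkGame (Fin 1) (λ _ → natGame k) Empty (λ ())

negNatGame : ℕ → Game
negNatGame zero = mkGame Empty (λ ()) Empty (λ ())
negNatGame (suc k) = mkGame Empty (λ ()) (Fin 1) (λ _ → negNatGame k)

intGame : ℤ → Game
intGame (+ k) = natGame k
intGame -[1+ k ] = negNatGame (suc k)

data Colour : Set where
  white black : Colour

opp : Colour → Colour
opp white = black
opp black = white

record RemovalGame (n : ℕ) : Set where
  field
    colour : Fin n → Colour
    ρ      : Subset n → Subset n
    ρ-sub  : ∀ A → ρ A ⊆ A
    ρ-mono : ∀ A B → A ⊆ B → ρ B ∩ A ⊆ ρ A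

module _ {n : ℕ} (E : RemovalGame n) where
  open RemovalGame E

  colourSet : Colour → Subset n
  colourSet c = tabulate λ x → pick (colour x) c
    where
    pick : Colour → Colour → _
    pick white white = inside
    pick black black = inside
    pick white black = outside
    pick black white = outside

  #col : Colour → Subset n → ℕ
  #col c A = ∣ A ∩ colourSet c ∣

  Move : Colour → Subset n → Set
  Move c A = Σ (Fin n) λ x → (x ∈ ρ A) × (colour x ≡ c)

  -- The Conway game of position A.  The fuel k bounds the depth of play;
  -- since every move removes an element of A, fuel k ≥ ∣ A ∣ is sufficient,
  -- and the game of X is  posGame n ⊤.
  posGame : ℕ → Subset n → Game
  posGame zero A = mkGame Empty (λ ()) Empty (λ ())
  posGame (suc k) A =
    mkGame (Move white A) (λ m → posGame k (A ∖ Σ.proj₁ m))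
           (Move black A) (λ m → posGame k (A ∖ Σ.proj₁ m))

  gameValue : Game
  gameValue = posGame n ⊤

  data Balanced (A : Subset n) : Set where
    balanced :
      (∀ x → x ∈ ρ A → Balanced (A ∖ x)) →
      (∀ c → (∀ x → x ∈ ρ A → colour x ≡ c) → ∣ A ∣ ≤ 2 * #col c A) →
      Balanced A

  -- Every play from A with player p to move (players alternating,
  -- each removing a removable element of his own colour, arbitrary choices)
  -- is won by player q (the player unable to move loses).
  data AllPlaysWonBy (q : Colour) : Colour → Subset n → Set where
    stuck : ∀ {p A} → ¬ Move p A → q ≡ opp p → AllPlaysWonBy q p A
    step  : ∀ {p A} → Move p A →
            ((m : Move p A) → AllPlaysWonBy q (opp p) (A ∖ Σ.proj₁ m)) →
            AllPlaysWonBy q p A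

  wCount bCount : ℕ
  wCount = #col white ⊤
  bCount = #col black ⊤

-- By induction on positions, A has the integer value d = w(A) - b(A): a White move removes a
-- white element and a Black move a black one, so the options have values d - 1 and d + 1, and
-- {d - 1 | d + 1} = d.  Balance is needed only when a player has no move: then every removable
-- element has the opponent's colour, so the opponent owns at least half of A, which gives d ≤ 0
-- when White is stuck and d ≥ 0 when Black is; these are exactly the conditions under which
-- { | d + 1} = d and {d - 1 | } = d.  The same facts decide every play: with p to move, White
-- wins if d > 0, Black if d < 0, and the opponent of p if d = 0; any move preserves this
-- prediction, and a stuck player is predicted to lose.
module Submission where

open import Defs
open import Data.Bool using (not)
open import Data.Empty using (⊥-elim)
open import Data.Fin using (zero; suc)
open import Data.Fin.Properties using (any?)
open import Data.Fin.Subset using (Subset; _∈_; _∉_; _∩_; _─_; ∁; ∣_∣; ⊤; ⊥; inside; outside)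
  renaming (_-_ to _∖_)
open import Data.Fin.Subset.Properties
  using (_∈?_; ∣⊤∣≡n; p─⊥≡p; x∈p∩q⁺; x∈p∩q⁻; x∈p⇒∣p-x∣<∣p∣)
open import Data.Integer as ℤ using (ℤ; +_; +[1+_]; -[1+_]; _-_; 0ℤ; +≤+; +<+; -<+)
open import Data.Integer.Properties as ℤ
  using ( <⇒≱; <-irrefl; ≰⇒>; <-≤-trans; ≤-trans; suc-mono; pred-mono; suc-+; minus-suc
        ; pred-suc; suc-pred; suc[i]≤j⇒i<j; i<j⇒suc[i]≤j; i≤pred[j]⇒i<j; i<j⇒i≤pred[j]
        ; i≤j⇒i-j≤0; i≤j⇒0≤j-i)
open import Data.Nat as ℕ using (ℕ; zero; suc; _+_; _*_; s≤s⁻¹)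
open import Data.Nat.Properties as ℕ using (+-suc; +-identityʳ; +-cancelʳ-≤; n≮0)
open import Data.Product using (_×_; _,_; ∃; proj₁; proj₂)
open import Data.Sum using (_⊎_; inj₁; inj₂; [_,_])
open import Data.Vec using (_∷_; []; here; there; lookup; tabulate)
open import Data.Vec.Properties using (lookup∘tabulate; tabulate∘lookup; tabulate-cong; lookup-map; lookup⇒[]=; []=⇒lookup)
open import Function using (_∘_)
open import Relation.Nullary using (¬_; Dec; yes; no; does)
open import Relation.Nullary.Decidable using (_×-dec_; dec-true; dec-false)
open import Relation.Binary.PropositionalEquality using (_≡_; _≢_; refl; sym; trans; cong; subst; module ≡-Reasoning)
open ≡-Reasoning

-- natGame 0 and negNatGame 0 are both { | } but not definitionally equal (distinct absurd lambdas).
≤natGame0⇒≤negNatGame0 : ∀ G → G ≤G natGame 0 → G ≤G negNatGame 0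
≤negNatGame0⇒≤natGame0 : ∀ G → G ≤G negNatGame 0 → G ≤G natGame 0
natGame0≤⇒negNatGame0≤ : ∀ G → natGame 0 ≤G G → negNatGame 0 ≤G G
negNatGame0≤⇒natGame0≤ : ∀ G → negNatGame 0 ≤G G → natGame 0 ≤G G
≤natGame0⇒≤negNatGame0 (mkGame I L J R) (noL , _) = (λ i → noL i ∘ negNatGame0≤⇒natGame0≤ (L i)) , λ ()
≤negNatGame0⇒≤natGame0 (mkGame I L J R) (noL , _) = (λ i → noL i ∘ natGame0≤⇒negNatGame0≤ (L i)) , λ ()
natGame0≤⇒negNatGame0≤ (mkGame I L J R) (_ , noR) = (λ ()) , λ j → noR j ∘ ≤negNatGame0⇒≤natGame0 (R j)
negNatGame0≤⇒natGame0≤ (mkGame I L J R) (_ , noR) = (λ ()) , λ j → noR j ∘ ≤natGame0⇒≤negNatGame0 (R j)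

module _ {I J : Set} {L : I → Game} {R : J → Game} where
  private
    G : Game
    G = mkGame I L J R

  ≤intGame⁺ : ∀ m → (∀ i → ¬ intGame m ≤G L i) → (m ℤ.< 0ℤ → ¬ intGame (ℤ.suc m) ≤G G) →
              G ≤G intGame m
  ≤intGame⁺ (+ zero)         noL noR = noL , λ ()
  ≤intGame⁺ +[1+ k ]         noL noR = noL , λ ()
  ≤intGame⁺ -[1+ zero ]      noL noR = noL , λ _ → noR -<+ ∘ negNatGame0≤⇒natGame0≤ G
  ≤intGame⁺ -[1+ suc k ]     noL noR = noL , λ _ → noR -<+

  ≤intGame⁻ : ∀ m → G ≤G intGame m →
              (∀ i → ¬ intGame m ≤G L i) × (m ℤ.< 0ℤ → ¬ intGame (ℤ.suc m) ≤G G)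
  ≤intGame⁻ (+ zero)         (noL , _)   = noL , λ { (+<+ ()) }
  ≤intGame⁻ +[1+ k ]         (noL , _)   = noL , λ { (+<+ ()) }
  ≤intGame⁻ -[1+ zero ]      (noL , noR) = noL , λ _ → noR zero ∘ natGame0≤⇒negNatGame0≤ G
  ≤intGame⁻ -[1+ suc k ]     (noL , noR) = noL , λ _ → noR zero

  intGame≤⁺ : ∀ m → (0ℤ ℤ.< m → ¬ G ≤G intGame (ℤ.pred m)) → (∀ j → ¬ R j ≤G intGame m) →
              intGame m ≤G G
  intGame≤⁺ (+ zero)    noL noR = (λ ()) , noR
  intGame≤⁺ +[1+ k ]    noL noR = (λ _ → noL (+<+ (ℕ.s≤s ℕ.z≤n))) , noR
  intGame≤⁺ -[1+ k ]    noL noR = (λ ()) , noR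

  intGame≤⁻ : ∀ m → intGame m ≤G G →
              (0ℤ ℤ.< m → ¬ G ≤G intGame (ℤ.pred m)) × (∀ j → ¬ R j ≤G intGame m)
  intGame≤⁻ (+ zero)    (_ , noR)   = (λ { (+<+ ()) }) , noR
  intGame≤⁻ +[1+ k ]    (noL , noR) = (λ _ → noL zero) , noR
  intGame≤⁻ -[1+ k ]    (_ , noR)   = (λ ()) , noR

-- The strict comparisons belong to the induction hypothesis because _≤G_ is defined through
-- negated comparisons with options.
record HasValue (G : Game) (d : ℤ) : Set where
  field
    ≤int : ∀ m → d ℤ.≤ m → G ≤G intGame m
    int≤ : ∀ m → m ℤ.≤ d → intGame m ≤G G
    ≰int : ∀ m → m ℤ.< d → ¬ G ≤G intGame m
    int≰ : ∀ m → d ℤ.< m → ¬ intGame m ≤G G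

open HasValue

HasValue⇒≈ : ∀ {G d} → HasValue G d → G ≈G intGame d
HasValue⇒≈ {d = d} v = ≤int v d ℤ.≤-refl , int≤ v d ℤ.≤-refl

-- Integer case of the simplicity theorem.  A game without Left options is ≤ 0 and one without
-- Right options is ≥ 0, hence the side conditions on d.
mkGame-HasValue : ∀ {I J : Set} {L : I → Game} {R : J → Game} d →
                  (∀ i → HasValue (L i) (ℤ.pred d)) → (∀ j → HasValue (R j) (ℤ.suc d)) →
                  I ⊎ d ℤ.≤ 0ℤ → J ⊎ 0ℤ ℤ.≤ d → HasValue (mkGame I L J R) d
mkGame-HasValue {I} {J} {L} {R} d valueL valueR leftOr rightOr = record
  { ≤int = ≤int′ ; int≤ = int≤′ ; ≰int = ≰int′ ; int≰ = int≰′ }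
  where
  G : Game
  G = mkGame I L J R

  ¬R≤ : ∀ {m} → m ℤ.≤ d → ∀ j → ¬ R j ≤G intGame m
  ¬R≤ {m} m≤d j = ≰int (valueR j) m (suc[i]≤j⇒i<j (suc-mono m≤d))

  ¬≤L : ∀ {m} → d ℤ.≤ m → ∀ i → ¬ intGame m ≤G L i
  ¬≤L {m} d≤m i = int≰ (valueL i) m (i≤pred[j]⇒i<j (pred-mono d≤m))

  -- For m ≤ 0, intGame m has no Left option; this breaks the circularity between int≤′ and ≰int′.
  int≤-nonpos : ∀ m → m ℤ.≤ d → m ℤ.≤ 0ℤ → intGame m ≤G G
  int≤-nonpos m m≤d m≤0 = intGame≤⁺ m (λ 0<m → ⊥-elim (<⇒≱ 0<m m≤0)) (¬R≤ m≤d)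

  ≰int′ : ∀ m → m ℤ.< d → ¬ G ≤G intGame m
  ≰int′ m m<d G≤m = [ (λ i → noL i (int≤ (valueL i) m (i<j⇒i≤pred[j] m<d)))
                    , (λ d≤0 → let m<0 = <-≤-trans m<d d≤0 in
                         noR m<0 (int≤-nonpos (ℤ.suc m) (i<j⇒suc[i]≤j m<d) (i<j⇒suc[i]≤j m<0)))
                    ] leftOr
    where
    noL = proj₁ (≤intGame⁻ m G≤m)
    noR = proj₂ (≤intGame⁻ m G≤m)

  int≤′ : ∀ m → m ℤ.≤ d → intGame m ≤G G
  int≤′ m m≤d = intGame≤⁺ m (λ _ → ≰int′ (ℤ.pred m) (i≤pred[j]⇒i<j (pred-mono m≤d))) (¬R≤ m≤d)

  int≰-nonpos : ∀ m → d ℤ.< m → m ℤ.≤ 0ℤ → ¬ intGame m ≤G G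
  int≰-nonpos m d<m m≤0 m≤G =
    [ (λ j → proj₂ (intGame≤⁻ m m≤G) j (≤int (valueR j) m (i<j⇒suc[i]≤j d<m)))
    , (λ 0≤d → <-irrefl refl (<-≤-trans d<m (≤-trans m≤0 0≤d)))
    ] rightOr

  ≤int′ : ∀ m → d ℤ.≤ m → G ≤G intGame m
  ≤int′ m d≤m = ≤intGame⁺ m (¬≤L d≤m)
    (λ m<0 → int≰-nonpos (ℤ.suc m) (suc[i]≤j⇒i<j (suc-mono d≤m)) (i<j⇒suc[i]≤j m<0))

  int≰′ : ∀ m → d ℤ.< m → ¬ intGame m ≤G G
  int≰′ m d<m m≤G with m ℤ.≤? 0ℤ
  ... | yes m≤0 = int≰-nonpos m d<m m≤0 m≤G
  ... | no  m≰0 = proj₁ (intGame≤⁻ m m≤G) (≰⇒> m≰0) (≤int′ (ℤ.pred m) (i<j⇒i≤pred[j] d<m))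

p-x∩q≡[p∩q]-x : ∀ {n} (p q : Subset n) x → (p ∖ x) ∩ q ≡ (p ∩ q) ∖ x
p-x∩q≡[p∩q]-x (s ∷ p) (t ∷ q) zero    = cong (outside ∷_) (begin
  (p ─ ⊥) ∩ q   ≡⟨ cong (_∩ q) (p─⊥≡p p) ⟩
  p ∩ q         ≡⟨ p─⊥≡p (p ∩ q) ⟨
  (p ∩ q) ─ ⊥   ∎)
p-x∩q≡[p∩q]-x (s ∷ p) (t ∷ q) (suc x) = cong (_ ∷_) (p-x∩q≡[p∩q]-x p q x)

x∉p⇒p-x≡p : ∀ {n} {p : Subset n} {x} → x ∉ p → p ∖ x ≡ p
x∉p⇒p-x≡p {p = inside  ∷ p} {zero}  x∉p = ⊥-elim (x∉p here)
x∉p⇒p-x≡p {p = outside ∷ p} {zero}  x∉p = cong (outside ∷_) (p─⊥≡p p)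
x∉p⇒p-x≡p {p = s ∷ p}       {suc x} x∉p = cong (s ∷_) (x∉p⇒p-x≡p (x∉p ∘ there))

x∈p⇒∣p∣≡1+∣p-x∣ : ∀ {n} {p : Subset n} {x} → x ∈ p → ∣ p ∣ ≡ suc ∣ p ∖ x ∣
x∈p⇒∣p∣≡1+∣p-x∣ {p = inside  ∷ p} here        = cong (suc ∘ ∣_∣) (sym (p─⊥≡p p))
x∈p⇒∣p∣≡1+∣p-x∣ {p = inside  ∷ p} (there x∈p) = cong suc (x∈p⇒∣p∣≡1+∣p-x∣ x∈p)
x∈p⇒∣p∣≡1+∣p-x∣ {p = outside ∷ p} (there x∈p) = x∈p⇒∣p∣≡1+∣p-x∣ x∈p

∣p∣≡∣p∩q∣+∣p∩∁q∣ : ∀ {n} (p q : Subset n) → ∣ p ∣ ≡ ∣ p ∩ q ∣ + ∣ p ∩ ∁ q ∣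
∣p∣≡∣p∩q∣+∣p∩∁q∣ []            []            = refl
∣p∣≡∣p∩q∣+∣p∩∁q∣ (inside  ∷ p) (inside  ∷ q) = cong suc (∣p∣≡∣p∩q∣+∣p∩∁q∣ p q)
∣p∣≡∣p∩q∣+∣p∩∁q∣ (inside  ∷ p) (outside ∷ q) =
  trans (cong suc (∣p∣≡∣p∩q∣+∣p∩∁q∣ p q)) (sym (+-suc _ _))
∣p∣≡∣p∩q∣+∣p∩∁q∣ (outside ∷ p) (t       ∷ q) = ∣p∣≡∣p∩q∣+∣p∩∁q∣ p q

m+n≤2*n⇒m≤n : ∀ {m n} → m + n ℕ.≤ 2 * n → m ℕ.≤ n
m+n≤2*n⇒m≤n {m} {n} m+n≤2n = +-cancelʳ-≤ n m n (subst (λ k → m + n ℕ.≤ n + k) (+-identityʳ n) m+n≤2n)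

_≟ᶜ_ : (c d : Colour) → Dec (c ≡ d)
white ≟ᶜ white = yes refl
black ≟ᶜ black = yes refl
white ≟ᶜ black = no λ ()
black ≟ᶜ white = no λ ()

c≢opp[c] : ∀ {c} → c ≢ opp c
c≢opp[c] {white} ()
c≢opp[c] {black} ()

does[a≟opp[c]] : ∀ a c → does (a ≟ᶜ opp c) ≡ not (does (a ≟ᶜ c))
does[a≟opp[c]] white white = refl
does[a≟opp[c]] white black = refl
does[a≟opp[c]] black white = refl
does[a≟opp[c]] black black = refl

a≢c⇒a≡opp[c] : ∀ {a c} → a ≢ c → a ≡ opp c
a≢c⇒a≡opp[c] {white} {white} a≢c = ⊥-elim (a≢c refl)
a≢c⇒a≡opp[c] {white} {black} _   = refl
a≢c⇒a≡opp[c] {black} {white} _   = refl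
a≢c⇒a≡opp[c] {black} {black} a≢c = ⊥-elim (a≢c refl)

outcome : Colour → ℤ → Colour
outcome p (+ zero)  = opp p
outcome p +[1+ _ ]  = white
outcome p -[1+ _ ]  = black

-- The change of value caused by a move of player c.
shift : Colour → ℤ → ℤ
shift white = ℤ.pred
shift black = ℤ.suc

outcome-shift : ∀ p d → outcome (opp p) (shift p d) ≡ outcome p d
outcome-shift white (+ zero)         = refl
outcome-shift white +[1+ zero ]      = refl
outcome-shift white +[1+ suc k ]     = refl
outcome-shift white -[1+ k ]         = refl
outcome-shift black (+ zero)         = refl
outcome-shift black +[1+ k ]         = refl
outcome-shift black -[1+ zero ]      = refl
outcome-shift black -[1+ suc k ]     = refl

outcome-white : ∀ {d} → d ℤ.≤ 0ℤ → outcome white d ≡ black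
outcome-white {+ zero}    _          = refl
outcome-white {+[1+ k ]}  (+≤+ ())
outcome-white { -[1+ k ]} _          = refl

outcome-black : ∀ {d} → 0ℤ ℤ.≤ d → outcome black d ≡ white
outcome-black {+ zero}    _ = refl
outcome-black {+[1+ k ]}  _ = refl
outcome-black { -[1+ k ]} ()

module _ {n : ℕ} (E : RemovalGame n) where
  open RemovalGame E

  -- colourSet is built from a where-bound function of Defs that cannot be named.  Both sides of
  -- the middle step reduce to it applied to colour x (its unused parameter E is ignored by
  -- conversion), and in the one-coloured copy of E that colour is a variable one can split on.
  lookup-colourSet : ∀ c x → lookup (colourSet E c) x ≡ does (colour x ≟ᶜ c)
  lookup-colourSet c x = begin
    lookup (colourSet E c) x                        ≡⟨ lookup∘tabulate _ x ⟩
    _                                               ≡⟨ lookup∘tabulate _ x ⟨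
    lookup (colourSet (monochrome (colour x)) c) x  ≡⟨ monochrome-lookup (colour x) c ⟩
    does (colour x ≟ᶜ c)                            ∎
    where
    monochrome : Colour → RemovalGame n
    monochrome a = record E { colour = λ _ → a }

    monochrome-lookup : ∀ a c → lookup (colourSet (monochrome a) c) x ≡ does (a ≟ᶜ c)
    monochrome-lookup white white = lookup∘tabulate _ x
    monochrome-lookup white black = lookup∘tabulate _ x
    monochrome-lookup black white = lookup∘tabulate _ x
    monochrome-lookup black black = lookup∘tabulate _ x

  x∈colourSet : ∀ {x c} → colour x ≡ c → x ∈ colourSet E c
  x∈colourSet {x} refl =
    lookup⇒[]= x _ (trans (lookup-colourSet _ x) (dec-true (colour x ≟ᶜ colour x) refl))

  x∉colourSet-opp : ∀ {x c} → colour x ≡ c → x ∉ colourSet E (opp c)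
  x∉colourSet-opp {x} refl x∈ = inside≢outside (begin
    inside                                   ≡⟨ []=⇒lookup x∈ ⟨
    lookup (colourSet E (opp (colour x))) x  ≡⟨ lookup-colourSet _ x ⟩
    does (colour x ≟ᶜ opp (colour x))        ≡⟨ dec-false (colour x ≟ᶜ opp (colour x)) c≢opp[c] ⟩
    outside                                  ∎)
    where
    inside≢outside : inside ≢ outside
    inside≢outside ()

  colourSet-opp : ∀ c → colourSet E (opp c) ≡ ∁ (colourSet E c)
  colourSet-opp c = begin
    colourSet E (opp c)                    ≡⟨ tabulate∘lookup _ ⟨
    tabulate (lookup (colourSet E (opp c))) ≡⟨ tabulate-cong lookup-opp ⟩
    tabulate (lookup (∁ (colourSet E c)))   ≡⟨ tabulate∘lookup _ ⟩
    ∁ (colourSet E c)                      ∎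
    where
    lookup-opp : ∀ x → lookup (colourSet E (opp c)) x ≡ lookup (∁ (colourSet E c)) x
    lookup-opp x = begin
      lookup (colourSet E (opp c)) x      ≡⟨ lookup-colourSet (opp c) x ⟩
      does (colour x ≟ᶜ opp c)           ≡⟨ does[a≟opp[c]] (colour x) c ⟩
      not (does (colour x ≟ᶜ c))         ≡⟨ cong not (lookup-colourSet c x) ⟨
      not (lookup (colourSet E c) x)      ≡⟨ lookup-map x not (colourSet E c) ⟨
      lookup (∁ (colourSet E c)) x        ∎

  ∣A∣≡#col+#col-opp : ∀ c A → ∣ A ∣ ≡ #col E c A + #col E (opp c) A
  ∣A∣≡#col+#col-opp c A = begin
    ∣ A ∣                                          ≡⟨ ∣p∣≡∣p∩q∣+∣p∩∁q∣ A (colourSet E c) ⟩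
    #col E c A + ∣ A ∩ ∁ (colourSet E c) ∣          ≡⟨ cong (λ S → #col E c A + ∣ A ∩ S ∣) (colourSet-opp c) ⟨
    #col E c A + #col E (opp c) A                  ∎

  #col-remove-own : ∀ {A x c} → colour x ≡ c → x ∈ A → #col E c A ≡ suc (#col E c (A ∖ x))
  #col-remove-own {A} {x} {c} colour≡c x∈A = begin
    ∣ A ∩ colourSet E c ∣             ≡⟨ x∈p⇒∣p∣≡1+∣p-x∣ (x∈p∩q⁺ (x∈A , x∈colourSet colour≡c)) ⟩
    suc ∣ (A ∩ colourSet E c) ∖ x ∣   ≡⟨ cong (suc ∘ ∣_∣) (p-x∩q≡[p∩q]-x A (colourSet E c) x) ⟨
    suc ∣ (A ∖ x) ∩ colourSet E c ∣   ∎

  #col-remove-opp : ∀ {A x c} → colour x ≡ c → #col E (opp c) (A ∖ x) ≡ #col E (opp c) A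
  #col-remove-opp {A} {x} {c} colour≡c = begin
    ∣ (A ∖ x) ∩ S ∣   ≡⟨ cong ∣_∣ (p-x∩q≡[p∩q]-x A S x) ⟩
    ∣ (A ∩ S) ∖ x ∣   ≡⟨ cong ∣_∣ (x∉p⇒p-x≡p (x∉colourSet-opp colour≡c ∘ proj₂ ∘ x∈p∩q⁻ A S)) ⟩
    ∣ A ∩ S ∣         ∎
    where
    S = colourSet E (opp c)

  value : Subset n → ℤ
  value A = + #col E white A - + #col E black A

  value-remove : ∀ {A x} c → colour x ≡ c → x ∈ A → value (A ∖ x) ≡ shift c (value A)
  value-remove {A} {x} white colour≡c x∈A = begin
    + w′ - + #col E black (A ∖ x)   ≡⟨ cong (λ k → + w′ - + k) (#col-remove-opp {A} colour≡c) ⟩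
    + w′ - + b                      ≡⟨ pred-suc _ ⟨
    ℤ.pred (ℤ.suc (+ w′ - + b))     ≡⟨ cong ℤ.pred (suc-+ w′ (ℤ.- + b)) ⟨
    ℤ.pred (+ suc w′ - + b)         ≡⟨ cong (λ k → ℤ.pred (+ k - + b)) (#col-remove-own colour≡c x∈A) ⟨
    ℤ.pred (value A)                ∎
    where
    w′ = #col E white (A ∖ x)
    b  = #col E black A
  value-remove {A} {x} black colour≡c x∈A = begin
    + #col E white (A ∖ x) - + b′   ≡⟨ cong (λ k → + k - + b′) (#col-remove-opp {A} colour≡c) ⟩
    + w - + b′                      ≡⟨ suc-pred _ ⟨
    ℤ.suc (ℤ.pred (+ w - + b′))     ≡⟨ cong ℤ.suc (minus-suc (+ w) b′) ⟨
    ℤ.suc (+ w - + suc b′)          ≡⟨ cong (λ k → ℤ.suc (+ w - + k)) (#col-remove-own colour≡c x∈A) ⟨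
    ℤ.suc (value A)                 ∎
    where
    w  = #col E white A
    b′ = #col E black (A ∖ x)

  Move? : ∀ c A → Dec (Move E c A)
  Move? c A = any? λ x → (x ∈? ρ A) ×-dec (colour x ≟ᶜ c)

  Move-or : ∀ {c A} {P : Set} → (¬ Move E c A → P) → Move E c A ⊎ P
  Move-or {c} {A} otherwise with Move? c A
  ... | yes move  = inj₁ move
  ... | no ¬move  = inj₂ (otherwise ¬move)

  ¬Move⇒#col≤#col-opp : ∀ {c A} → Balanced E A → ¬ Move E c A → #col E c A ℕ.≤ #col E (opp c) A
  ¬Move⇒#col≤#col-opp {c} {A} (balanced _ half) ¬move =
    m+n≤2*n⇒m≤n (subst (ℕ._≤ 2 * #col E (opp c) A) (∣A∣≡#col+#col-opp c A) (half (opp c) removable-opp))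
    where
    removable-opp : ∀ x → x ∈ ρ A → colour x ≡ opp c
    removable-opp x x∈ρA = a≢c⇒a≡opp[c] λ colour≡c → ¬move (x , x∈ρA , colour≡c)

  ¬Move-white⇒value≤0 : ∀ {A} → Balanced E A → ¬ Move E white A → value A ℤ.≤ 0ℤ
  ¬Move-white⇒value≤0 bal ¬move = i≤j⇒i-j≤0 (+≤+ (¬Move⇒#col≤#col-opp bal ¬move))

  ¬Move-black⇒0≤value : ∀ {A} → Balanced E A → ¬ Move E black A → 0ℤ ℤ.≤ value A
  ¬Move-black⇒0≤value bal ¬move = i≤j⇒0≤j-i (+≤+ (¬Move⇒#col≤#col-opp bal ¬move))

  ∣A∣≤0⇒¬Move : ∀ {c A} → ∣ A ∣ ℕ.≤ 0 → ¬ Move E c A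
  ∣A∣≤0⇒¬Move {A = A} ∣A∣≤0 (x , x∈ρA , _) = n≮0 (ℕ.<-≤-trans (x∈p⇒∣p-x∣<∣p∣ (ρ-sub A x∈ρA)) ∣A∣≤0)

  posGame-HasValue : ∀ k A → Balanced E A → ∣ A ∣ ℕ.≤ k → HasValue (posGame E k A) (value A)
  posGame-HasValue zero A bal ∣A∣≤0 = mkGame-HasValue (value A) (λ ()) (λ ())
    (inj₂ (¬Move-white⇒value≤0 bal (∣A∣≤0⇒¬Move ∣A∣≤0)))
    (inj₂ (¬Move-black⇒0≤value bal (∣A∣≤0⇒¬Move ∣A∣≤0)))
  posGame-HasValue (suc k) A bal@(balanced options-balanced _) ∣A∣≤1+k = mkGame-HasValue (value A)
    (option-HasValue white) (option-HasValue black)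
    (Move-or (¬Move-white⇒value≤0 bal)) (Move-or (¬Move-black⇒0≤value bal))
    where
    option-HasValue : ∀ c (move : Move E c A) → HasValue (posGame E k (A ∖ proj₁ move)) (shift c (value A))
    option-HasValue c (x , x∈ρA , colour≡c) =
      subst (HasValue _) (value-remove c colour≡c (ρ-sub A x∈ρA))
        (posGame-HasValue k (A ∖ x) (options-balanced x x∈ρA)
          (s≤s⁻¹ (ℕ.<-≤-trans (x∈p⇒∣p-x∣<∣p∣ (ρ-sub A x∈ρA)) ∣A∣≤1+k)))

  outcome-stuck : ∀ p {A} → Balanced E A → ¬ Move E p A → outcome p (value A) ≡ opp p
  outcome-stuck white bal ¬move = outcome-white (¬Move-white⇒value≤0 bal ¬move)
  outcome-stuck black bal ¬move = outcome-black (¬Move-black⇒0≤value bal ¬move)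

  allPlaysWonBy-outcome : ∀ p A → Balanced E A → AllPlaysWonBy E (outcome p (value A)) p A
  allPlaysWonBy-outcome p A bal@(balanced options-balanced _) with Move? p A
  ... | no ¬move = stuck ¬move (outcome-stuck p bal ¬move)
  ... | yes move = step move after
    where
    after : (move : Move E p A) → AllPlaysWonBy E (outcome p (value A)) (opp p) (A ∖ proj₁ move)
    after (x , x∈ρA , colour≡p) =
      subst (λ q → AllPlaysWonBy E q (opp p) (A ∖ x))
        (trans (cong (outcome (opp p)) (value-remove p colour≡p (ρ-sub A x∈ρA))) (outcome-shift p (value A)))
        (allPlaysWonBy-outcome (opp p) (A ∖ x) (options-balanced x x∈ρA))

mainTheorem2 : (n : ℕ) (E : RemovalGame n) → Balanced E ⊤ →
    (gameValue E ≈G intGame (+ wCount E - + bCount E)) ×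
    (∀ first → ∃ λ winner → AllPlaysWonBy E winner first ⊤)
mainTheorem2 n E bal =
  HasValue⇒≈ (posGame-HasValue E n ⊤ bal (ℕ.≤-reflexive (∣⊤∣≡n n))) ,
  λ first → outcome first (value E ⊤) , allPlaysWonBy-outcome E first ⊤ bal
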